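{- In the setting described in the context, the matrices $B_0,\dots,B_D$ form a basis of the subalgebra $M$ of $\mathrm{Mat}_{D+1}(\mathbb R)$ generated by $A$, and the matrices $B_0^*,\dots,B_D^*$ form a basis of the subalgebra $M^*$ of $\mathrm{Mat}_{D+1}(\mathbb R)$ generated by $A^*$.
   Context: Let $D$ be a positive integer. Define $c_i=\frac{3(D-i+1)i(D+i+1)}{D(D+2)(2i+1)}$ ($1\le i\le D$), $a_i=\frac{3i(i+1)}{D(D+2)}$ ($0\le i\le D$), $b_i=\frac{3(D-i)(i+1)(D+i+2)}{D(D+2)(2i+1)}$ ($0\le i\le D-1$), $\theta_i=3-2a_i$ ($0\le i\le D$). Matrices are $(D+1)\times(D+1)$ real, indices $0,\dots,D$. $A$ is the tridiagonal matrix with $A_{i,i}=a_i$, $A_{i,i+1}=b_i$, $A_{i,i-1}=c_i$, other entries $0$; $A^*=\mathrm{diag}(\theta_0,\dots,\theta_D)$. Polynomials $u_0,\dots,u_D$: $u_0=1$, $u_1=\lambda/3$, $\lambda u_i=b_iu_{i+1}+a_iu_i+c_iu_{i-1}$ ($1\le i\le D-1$); $k_i=\frac{b_0\cdots b_{i-1}}{c_1\cdots c_i}$; $v_i=k_iu_i$; $B_i=v_i(A)$, $B_i^*=v_i(A^*)$.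
   Formalization: The matrices have rational entries instead of real ones, and the subalgebras M and M* generated by A and A*, linear independence and spanning are all taken over ℚ. -}

module Defs where

open import Data.Nat as ℕ using (ℕ; zero; suc)
open import Data.Fin using (Fin; toℕ)
open import Data.List using (List; []; _∷_)
open import Data.Product using (Σ; ∃; _×_)
open import Data.Rational as ℚ using (ℚ; 0ℚ; 1ℚ; _+_; _*_; -_; normalize; _≟_; 1/_; ≢-nonZero)
open import Relation.Nullary using (yes; no)
open import Relation.Binary.PropositionalEquality using (_≡_)

-- Totalised arithmetic helpers (only ever used with nonzero denominators
-- in the range of indices relevant to the paper).

frac : ℕ → ℕ → ℚ
frac m zero    = 0ℚ
frac m (suc n) = normalize m (suc n)

_÷'_ : ℚ → ℚ → ℚ
p ÷' q with q ≟ 0ℚ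
... | yes _  = 0ℚ
... | no q≢0 = p * (1/_ q {{≢-nonZero q≢0}})

-- The parameters of the context (D is the diameter).

c : ℕ → ℕ → ℚ
c D i = frac (3 ℕ.* ((D ℕ.∸ i) ℕ.+ 1) ℕ.* i ℕ.* (D ℕ.+ i ℕ.+ 1))
             (D ℕ.* (D ℕ.+ 2) ℕ.* (2 ℕ.* i ℕ.+ 1))

a : ℕ → ℕ → ℚ
a D i = frac (3 ℕ.* i ℕ.* (i ℕ.+ 1)) (D ℕ.* (D ℕ.+ 2))

b : ℕ → ℕ → ℚ
b D i = frac (3 ℕ.* (D ℕ.∸ i) ℕ.* (i ℕ.+ 1) ℕ.* (D ℕ.+ i ℕ.+ 2))
             (D ℕ.* (D ℕ.+ 2) ℕ.* (2 ℕ.* i ℕ.+ 1))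

θ : ℕ → ℕ → ℚ
θ D i = frac 3 1 + (- (frac 2 1 * a D i))

Mat : ℕ → Set
Mat n = Fin n → Fin n → ℚ

_≈M_ : ∀ {n} → Mat n → Mat n → Set
X ≈M Y = ∀ r s → X r s ≡ Y r s

zeroM : ∀ {n} → Mat n
zeroM r s = 0ℚ

idM : ∀ {n} → Mat n
idM {suc n} Fin.zero Fin.zero = 1ℚ
idM {suc n} Fin.zero (Fin.suc s) = 0ℚ
idM {suc n} (Fin.suc r) Fin.zero = 0ℚ
idM {suc n} (Fin.suc r) (Fin.suc s) = idM {n} r s

_+M_ : ∀ {n} → Mat n → Mat n → Mat n
(X +M Y) r s = X r s + Y r s

_·M_ : ∀ {n} → ℚ → Mat n → Mat n
(k ·M X) r s = k * X r s

ΣF : ∀ {n} → (Fin n → ℚ) → ℚ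
ΣF {zero}  f = 0ℚ
ΣF {suc n} f = f Fin.zero + ΣF {n} (λ j → f (Fin.suc j))

_*M_ : ∀ {n} → Mat n → Mat n → Mat n
(X *M Y) r s = ΣF (λ j → X r j * Y j s)

Amat : (D : ℕ) → Mat (suc D)
Amat D r s with toℕ r | toℕ s
... | i | j with i ℕ.≟ j | suc i ℕ.≟ j | i ℕ.≟ suc j
...   | yes _ | _     | _     = a D i
...   | no _  | yes _ | _     = b D i
...   | no _  | no _  | yes _ = c D i
...   | no _  | no _  | no _  = 0ℚ

A*mat : (D : ℕ) → Mat (suc D)
A*mat D r s with toℕ r ℕ.≟ toℕ s
... | yes _ = θ D (toℕ r)
... | no _  = 0ℚ

-- Polynomials over ℚ in one variable λ, as coefficient lists
-- (constant coefficient first).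

Poly : Set
Poly = List ℚ

infixl 6 _+P_
infixr 7 _·P_
infixl 6 _+M_
infixr 7 _·M_

_+P_ : Poly → Poly → Poly
[]       +P q        = q
(x ∷ p)  +P []       = x ∷ p
(x ∷ p)  +P (y ∷ q)  = (x + y) ∷ (p +P q)

_·P_ : ℚ → Poly → Poly
k ·P []      = []
k ·P (x ∷ p) = (k * x) ∷ (k ·P p)

λ·P : Poly → Poly
λ·P p = 0ℚ ∷ p

evalM : ∀ {n} → Poly → Mat n → Mat n
evalM []      X = zeroM
evalM (x ∷ p) X = (x ·M idM) +M (X *M evalM p X)

-- the pair (u_i, u_{i+1}) defined by
--   u_0 = 1, u_1 = λ/3,
--   u_{i+1} = (λ u_i - a_i u_i - c_i u_{i-1}) / b_i    (i ≥ 1)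
uPair : ℕ → ℕ → Poly × Poly
uPair D zero    = (1ℚ ∷ []) Data.Product., (0ℚ ∷ frac 1 3 ∷ [])
uPair D (suc i) with uPair D i
... | p Data.Product., q =
  q Data.Product., ((1ℚ ÷' b D (suc i)) ·P
        (λ·P q +P ((- a D (suc i)) ·P q +P ((- c D (suc i)) ·P p))))

u : ℕ → ℕ → Poly
u D i = Data.Product.proj₁ (uPair D i)

prodB : ℕ → ℕ → ℚ
prodB D zero    = 1ℚ
prodB D (suc i) = prodB D i * b D i

prodC : ℕ → ℕ → ℚ
prodC D zero    = 1ℚ
prodC D (suc i) = prodC D i * c D (suc i)

k : ℕ → ℕ → ℚ
k D i = prodB D i ÷' prodC D i

v : ℕ → ℕ → Poly
v D i = k D i ·P u D i

B : (D : ℕ) → Fin (suc D) → Mat (suc D)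
B D i = evalM (v D (toℕ i)) (Amat D)

B* : (D : ℕ) → Fin (suc D) → Mat (suc D)
B* D i = evalM (v D (toℕ i)) (A*mat D)

LinComb : ∀ {m n} → (Fin m → ℚ) → (Fin m → Mat n) → Mat n
LinComb {zero}  κ X = zeroM
LinComb {suc m} κ X = (κ Fin.zero ·M X Fin.zero) +M
                      LinComb {m} (λ j → κ (Fin.suc j)) (λ j → X (Fin.suc j))

LinIndep : ∀ {m n} → (Fin m → Mat n) → Set
LinIndep {m} X = ∀ (κ : Fin m → ℚ) → LinComb κ X ≈M zeroM → ∀ i → κ i ≡ 0ℚ

-- the (unital) subalgebra generated by a matrix Y: all p(Y), p a polynomial
InSubalgebraGen : ∀ {n} → Mat n → Mat n → Set
InSubalgebraGen Y X = Σ Poly λ p → X ≈M evalM p Y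

IsBasisOf : ∀ {m n} → (Mat n → Set) → (Fin m → Mat n) → Set
IsBasisOf {m} S X =
  (∀ i → S (X i)) ×
  LinIndep X ×
  (∀ Y → S Y → Σ (Fin m → ℚ) λ κ → Y ≈M LinComb κ X)

{-# OPTIONS --safe #-}

-- Column 0 of B i = v i (A) is the unit vector e i: the recurrence defining u i mirrors the
-- tridiagonal shape of A, and k i normalises the one surviving entry. So e 0 is a cyclic
-- vector for A; as polynomials in A commute, p (A) is determined by its first column, and
-- B 0, …, B D is a basis of M. A* is diagonal with the distinct entries θ 0, …, θ D, so
-- p (A*) only depends on the values p (θ j): interpolation brings p to degree ≤ D, where
-- the u i (deg u i = i) span, hence the B* i span M*. If Σ κ i B* i = 0, the polynomial
-- Σ κ i v i has degree ≤ D and the D + 1 roots θ j, so it is zero; then Σ κ i B i = 0,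
-- and κ = 0 by the first part.

module Submission where

open import Defs
open import Data.Nat using (ℕ; _≤_)
open import Data.Product using (_×_)

open import Algebra.Bundles using (CommutativeRing)
open import Data.Empty using (⊥-elim)
open import Data.Fin using (Fin; toℕ; fromℕ<) renaming (zero to fzero; suc to fsuc)
open import Data.Fin.Properties using (toℕ<n; toℕ-fromℕ<; toℕ-injective; suc-injective; 0≢1+n)
import Data.Integer as ℤ
import Data.Integer.Properties as ℤₚ
open import Data.List using ([]; _∷_; length)
open import Data.List.Relation.Unary.All using (All; []; _∷_)
open import Data.Nat as ℕ using (zero; suc; _<_; z≤n; s≤s)
import Data.Nat.Properties as ℕₚ
import Data.Nat.Solver as ℕ-Solver
open import Data.Product using (Σ; _,_; proj₁; proj₂)
open import Data.Rational as ℚ using (ℚ; 0ℚ; 1ℚ; _+_; _*_; -_; _-_; 1/_; ≢-nonZero)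
import Data.Rational.Properties as ℚₚ
open import Data.Rational.Solver using (module +-*-Solver)
open import Data.Rational.Unnormalised using (mkℚᵘ; *≡*)
open import Data.Sum using (inj₁; inj₂)
open import Function.Definitions using (Injective)
open import Relation.Binary.Bundles using (Setoid)
open import Relation.Binary.Definitions using (tri<; tri≈; tri>)
open import Relation.Binary.PropositionalEquality
import Relation.Binary.Reasoning.Setoid
open import Relation.Nullary using (yes; no)

open import Algebra.Properties.Group ℚₚ.+-0-group using ()
  renaming (x∙y⁻¹≈ε⇒x≈y to p-q≡0⇒p≡q)
open import Algebra.Properties.Semiring.Sum (CommutativeRing.semiring ℚₚ.+-*-commutativeRing)
  using (sum; sum-cong-≗; sum-replicate-zero; ∑-distrib-+; ∑-comm; *-distribˡ-sum)
open +-*-Solver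

p÷'q≡p*1/q : ∀ p {q} (q≢0 : q ≢ 0ℚ) → p ÷' q ≡ p * 1/_ q {{≢-nonZero q≢0}}
p÷'q≡p*1/q p {q} q≢0 with q ℚ.≟ 0ℚ
... | yes q≡0 = ⊥-elim (q≢0 q≡0)
... | no _    = refl

q*[p÷'q]≡p : ∀ p {q} → q ≢ 0ℚ → q * (p ÷' q) ≡ p
q*[p÷'q]≡p p {q} q≢0 = begin
  q * (p ÷' q)  ≡⟨ cong (q *_) (p÷'q≡p*1/q p q≢0) ⟩
  q * (p * q⁻¹) ≡⟨ solve 3 (λ q p q⁻¹ → q :* (p :* q⁻¹) := p :* (q :* q⁻¹)) refl q p q⁻¹ ⟩
  p * (q * q⁻¹) ≡⟨ cong (p *_) (ℚₚ.*-inverseʳ q {{≢-nonZero q≢0}}) ⟩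
  p * 1ℚ        ≡⟨ ℚₚ.*-identityʳ p ⟩
  p             ∎
  where
  open ≡-Reasoning
  q⁻¹ = 1/_ q {{≢-nonZero q≢0}}

p≢0∧p*q≡0⇒q≡0 : ∀ {p q} → p ≢ 0ℚ → p * q ≡ 0ℚ → q ≡ 0ℚ
p≢0∧p*q≡0⇒q≡0 {p} {q} p≢0 pq≡0 = begin
  q              ≡⟨ ℚₚ.*-identityˡ q ⟨
  1ℚ * q         ≡⟨ cong (_* q) (ℚₚ.*-inverseˡ p {{≢-nonZero p≢0}}) ⟨
  (p⁻¹ * p) * q  ≡⟨ ℚₚ.*-assoc p⁻¹ p q ⟩
  p⁻¹ * (p * q)  ≡⟨ cong (p⁻¹ *_) pq≡0 ⟩
  p⁻¹ * 0ℚ       ≡⟨ ℚₚ.*-zeroʳ p⁻¹ ⟩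
  0ℚ             ∎
  where
  open ≡-Reasoning
  p⁻¹ = 1/_ p {{≢-nonZero p≢0}}

p≢0∧q≢0⇒p*q≢0 : ∀ {p q} → p ≢ 0ℚ → q ≢ 0ℚ → p * q ≢ 0ℚ
p≢0∧q≢0⇒p*q≢0 p≢0 q≢0 pq≡0 = q≢0 (p≢0∧p*q≡0⇒q≡0 p≢0 pq≡0)

-- Finite sums and matrices

ΣF≡sum : ∀ {n} (f : Fin n → ℚ) → ΣF f ≡ sum f
ΣF≡sum {zero}  f = refl
ΣF≡sum {suc n} f = cong (f fzero +_) (ΣF≡sum (λ j → f (fsuc j)))

ΣF-cong : ∀ {n} {f g : Fin n → ℚ} → (∀ j → f j ≡ g j) → ΣF f ≡ ΣF g
ΣF-cong {f = f} {g} f≗g = trans (ΣF≡sum f) (trans (sum-cong-≗ f≗g) (sym (ΣF≡sum g)))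

ΣF-zero : ∀ n → ΣF {n} (λ _ → 0ℚ) ≡ 0ℚ
ΣF-zero n = trans (ΣF≡sum {n} (λ _ → 0ℚ)) (sum-replicate-zero n)

ΣF-distrib-+ : ∀ {n} (f g : Fin n → ℚ) → ΣF (λ j → f j + g j) ≡ ΣF f + ΣF g
ΣF-distrib-+ f g = trans (ΣF≡sum (λ j → f j + g j))
  (trans (∑-distrib-+ f g) (sym (cong₂ _+_ (ΣF≡sum f) (ΣF≡sum g))))

*-distribˡ-ΣF : ∀ {n} x (f : Fin n → ℚ) → x * ΣF f ≡ ΣF (λ j → x * f j)
*-distribˡ-ΣF x f = trans (cong (x *_) (ΣF≡sum f))
  (trans (*-distribˡ-sum x f) (sym (ΣF≡sum (λ j → x * f j))))

*-distribʳ-ΣF : ∀ {n} x (f : Fin n → ℚ) → ΣF f * x ≡ ΣF (λ j → f j * x)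
*-distribʳ-ΣF x f = trans (ℚₚ.*-comm (ΣF f) x)
  (trans (*-distribˡ-ΣF x f) (ΣF-cong (λ j → ℚₚ.*-comm x (f j))))

ΣF-comm : ∀ {m n} (f : Fin m → Fin n → ℚ) →
          ΣF (λ i → ΣF (f i)) ≡ ΣF (λ j → ΣF (λ i → f i j))
ΣF-comm f = begin
  ΣF (λ i → ΣF (f i))         ≡⟨ ΣF-cong (λ i → ΣF≡sum (f i)) ⟩
  ΣF (λ i → sum (f i))        ≡⟨ ΣF≡sum (λ i → sum (f i)) ⟩
  sum (λ i → sum (f i))       ≡⟨ ∑-comm f ⟩
  sum (λ j → sum (λ i → f i j)) ≡⟨ ΣF≡sum (λ j → sum (λ i → f i j)) ⟨
  ΣF (λ j → sum (λ i → f i j))  ≡⟨ ΣF-cong (λ j → ΣF≡sum (λ i → f i j)) ⟨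
  ΣF (λ j → ΣF (λ i → f i j)) ∎
  where open ≡-Reasoning

idM-sym : ∀ {n} (r s : Fin n) → idM r s ≡ idM s r
idM-sym {suc n} fzero    fzero    = refl
idM-sym {suc n} fzero    (fsuc s) = refl
idM-sym {suc n} (fsuc r) fzero    = refl
idM-sym {suc n} (fsuc r) (fsuc s) = idM-sym r s

ΣF-idMˡ : ∀ {n} (r : Fin n) (f : Fin n → ℚ) → ΣF (λ j → idM r j * f j) ≡ f r
ΣF-idMˡ {suc n} fzero f = begin
  1ℚ * f fzero + ΣF (λ j → 0ℚ * f (fsuc j))
    ≡⟨ cong₂ _+_ (ℚₚ.*-identityˡ (f fzero))
                 (trans (ΣF-cong (λ j → ℚₚ.*-zeroˡ (f (fsuc j)))) (ΣF-zero n)) ⟩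
  f fzero + 0ℚ ≡⟨ ℚₚ.+-identityʳ (f fzero) ⟩
  f fzero      ∎
  where open ≡-Reasoning
ΣF-idMˡ {suc n} (fsuc r) f = begin
  0ℚ * f fzero + ΣF (λ j → idM r j * f (fsuc j))
    ≡⟨ cong₂ _+_ (ℚₚ.*-zeroˡ (f fzero)) (ΣF-idMˡ r (λ j → f (fsuc j))) ⟩
  0ℚ + f (fsuc r) ≡⟨ ℚₚ.+-identityˡ (f (fsuc r)) ⟩
  f (fsuc r)      ∎
  where open ≡-Reasoning

idM-refl : ∀ {n} (r : Fin n) → idM r r ≡ 1ℚ
idM-refl {suc n} fzero    = refl
idM-refl {suc n} (fsuc r) = idM-refl r

ΣF-idMʳ : ∀ {n} (s : Fin n) (f : Fin n → ℚ) → ΣF (λ j → f j * idM j s) ≡ f s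
ΣF-idMʳ s f = trans (ΣF-cong (λ j → trans (ℚₚ.*-comm (f j) (idM j s)) (cong (_* f j) (idM-sym j s))))
                    (ΣF-idMˡ s f)

δ : ℕ → ℕ → ℚ
δ zero    zero    = 1ℚ
δ zero    (suc _) = 0ℚ
δ (suc _) zero    = 0ℚ
δ (suc i) (suc j) = δ i j

idM≡δ : ∀ {n} (r s : Fin n) → idM r s ≡ δ (toℕ r) (toℕ s)
idM≡δ {suc n} fzero    fzero    = refl
idM≡δ {suc n} fzero    (fsuc s) = refl
idM≡δ {suc n} (fsuc r) fzero    = refl
idM≡δ {suc n} (fsuc r) (fsuc s) = idM≡δ r s

δ-refl : ∀ i → δ i i ≡ 1ℚ
δ-refl zero    = refl
δ-refl (suc i) = δ-refl i

δ-≢ : ∀ {i j} → i ≢ j → δ i j ≡ 0ℚ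
δ-≢ {zero}  {zero}  i≢j = ⊥-elim (i≢j refl)
δ-≢ {zero}  {suc j} i≢j = refl
δ-≢ {suc i} {zero}  i≢j = refl
δ-≢ {suc i} {suc j} i≢j = δ-≢ (λ i≡j → i≢j (cong suc i≡j))

module _ {n : ℕ} where

  ≈M-setoid : Setoid _ _
  ≈M-setoid = record
    { Carrier       = Mat n
    ; _≈_           = _≈M_
    ; isEquivalence = record
      { refl  = λ r s → refl
      ; sym   = λ X≈Y r s → sym (X≈Y r s)
      ; trans = λ X≈Y Y≈Z r s → trans (X≈Y r s) (Y≈Z r s)
      }
    }

  module ≈M-Reasoning = Relation.Binary.Reasoning.Setoid ≈M-setoid

  +M-cong : ∀ {X X' Y Y' : Mat n} → X ≈M X' → Y ≈M Y' → (X +M Y) ≈M (X' +M Y')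
  +M-cong X≈X' Y≈Y' r s = cong₂ _+_ (X≈X' r s) (Y≈Y' r s)

  *M-congˡ : ∀ (X : Mat n) {Y Y'} → Y ≈M Y' → (X *M Y) ≈M (X *M Y')
  *M-congˡ X Y≈Y' r s = ΣF-cong (λ j → cong (X r j *_) (Y≈Y' j s))

  *M-congʳ : ∀ (Y : Mat n) {X X'} → X ≈M X' → (X *M Y) ≈M (X' *M Y)
  *M-congʳ Y X≈X' r s = ΣF-cong (λ j → cong (_* Y j s) (X≈X' r j))

  *M-assoc : ∀ (X Y Z : Mat n) → ((X *M Y) *M Z) ≈M (X *M (Y *M Z))
  *M-assoc X Y Z r s = begin
    ΣF (λ j → ΣF (λ l → X r l * Y l j) * Z j s)
      ≡⟨ ΣF-cong (λ j → *-distribʳ-ΣF (Z j s) (λ l → X r l * Y l j)) ⟩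
    ΣF (λ j → ΣF (λ l → X r l * Y l j * Z j s))
      ≡⟨ ΣF-comm (λ j l → X r l * Y l j * Z j s) ⟩
    ΣF (λ l → ΣF (λ j → X r l * Y l j * Z j s))
      ≡⟨ ΣF-cong (λ l → ΣF-cong (λ j → ℚₚ.*-assoc (X r l) (Y l j) (Z j s))) ⟩
    ΣF (λ l → ΣF (λ j → X r l * (Y l j * Z j s)))
      ≡⟨ ΣF-cong (λ l → *-distribˡ-ΣF (X r l) (λ j → Y l j * Z j s)) ⟨
    ΣF (λ l → X r l * ΣF (λ j → Y l j * Z j s)) ∎
    where open ≡-Reasoning

  *M-distribˡ : ∀ (X Y Z : Mat n) → (X *M (Y +M Z)) ≈M ((X *M Y) +M (X *M Z))
  *M-distribˡ X Y Z r s =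
    trans (ΣF-cong (λ j → ℚₚ.*-distribˡ-+ (X r j) (Y j s) (Z j s)))
          (ΣF-distrib-+ (λ j → X r j * Y j s) (λ j → X r j * Z j s))

  *M-distribʳ : ∀ (X Y Z : Mat n) → ((Y +M Z) *M X) ≈M ((Y *M X) +M (Z *M X))
  *M-distribʳ X Y Z r s =
    trans (ΣF-cong (λ j → ℚₚ.*-distribʳ-+ (X j s) (Y r j) (Z r j)))
          (ΣF-distrib-+ (λ j → Y r j * X j s) (λ j → Z r j * X j s))

  *M-zeroˡ : ∀ (X : Mat n) → (zeroM *M X) ≈M zeroM
  *M-zeroˡ X r s = trans (ΣF-cong (λ j → ℚₚ.*-zeroˡ (X j s))) (ΣF-zero n)

  *M-zeroʳ : ∀ (X : Mat n) → (X *M zeroM) ≈M zeroM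
  *M-zeroʳ X r s = trans (ΣF-cong (λ j → ℚₚ.*-zeroʳ (X r j))) (ΣF-zero n)

  *M-·Mʳ : ∀ k (X Y : Mat n) → (X *M (k ·M Y)) ≈M (k ·M (X *M Y))
  *M-·Mʳ k X Y r s = trans
    (ΣF-cong (λ j → solve 3 (λ x k y → x :* (k :* y) := k :* (x :* y)) refl (X r j) k (Y j s)))
    (sym (*-distribˡ-ΣF k (λ j → X r j * Y j s)))

  *M-scalarˡ : ∀ k (X : Mat n) → ((k ·M idM) *M X) ≈M (k ·M X)
  *M-scalarˡ k X r s = trans (ΣF-cong (λ j → ℚₚ.*-assoc k (idM r j) (X j s)))
    (trans (sym (*-distribˡ-ΣF k (λ j → idM r j * X j s))) (cong (k *_) (ΣF-idMˡ r (λ j → X j s))))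

  *M-scalarʳ : ∀ k (X : Mat n) → (X *M (k ·M idM)) ≈M (k ·M X)
  *M-scalarʳ k X r s = trans (*M-·Mʳ k X idM r s) (cong (k *_) (ΣF-idMʳ s (X r)))

  Commute : Mat n → Mat n → Set
  Commute X Y = (X *M Y) ≈M (Y *M X)

  commute-sym : ∀ {X Y} → Commute X Y → Commute Y X
  commute-sym XY≈YX r s = sym (XY≈YX r s)

  commute-zeroM : ∀ X → Commute X zeroM
  commute-zeroM X r s = trans (*M-zeroʳ X r s) (sym (*M-zeroˡ X r s))

  commute-scalar : ∀ X k → Commute X (k ·M idM)
  commute-scalar X k r s = trans (*M-scalarʳ k X r s) (sym (*M-scalarˡ k X r s))

  commute-+M : ∀ {X Y Z} → Commute X Y → Commute X Z → Commute X (Y +M Z)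
  commute-+M {X} {Y} {Z} XY≈YX XZ≈ZX = begin
    X *M (Y +M Z)           ≈⟨ *M-distribˡ X Y Z ⟩
    (X *M Y) +M (X *M Z)    ≈⟨ +M-cong XY≈YX XZ≈ZX ⟩
    (Y *M X) +M (Z *M X)    ≈⟨ *M-distribʳ X Y Z ⟨
    (Y +M Z) *M X           ∎
    where open ≈M-Reasoning

  commute-*M : ∀ {X Y Z} → Commute X Y → Commute X Z → Commute X (Y *M Z)
  commute-*M {X} {Y} {Z} XY≈YX XZ≈ZX = begin
    X *M (Y *M Z)   ≈⟨ *M-assoc X Y Z ⟨
    (X *M Y) *M Z   ≈⟨ *M-congʳ Z XY≈YX ⟩
    (Y *M X) *M Z   ≈⟨ *M-assoc Y X Z ⟩
    Y *M (X *M Z)   ≈⟨ *M-congˡ Y XZ≈ZX ⟩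
    Y *M (Z *M X)   ≈⟨ *M-assoc Y Z X ⟨
    (Y *M Z) *M X   ∎
    where open ≈M-Reasoning

-- Polynomials

linCombP : ∀ {m} → (Fin m → ℚ) → (Fin m → Poly) → Poly
linCombP {zero}  κ ps = []
linCombP {suc m} κ ps = κ fzero ·P ps fzero +P linCombP (λ i → κ (fsuc i)) (λ i → ps (fsuc i))

LinComb-entry : ∀ {m n} (κ : Fin m → ℚ) (Xs : Fin m → Mat n) r s →
                LinComb κ Xs r s ≡ ΣF (λ i → κ i * Xs i r s)
LinComb-entry {zero}  κ Xs r s = refl
LinComb-entry {suc m} κ Xs r s =
  cong (κ fzero * Xs fzero r s +_) (LinComb-entry (λ i → κ (fsuc i)) (λ i → Xs (fsuc i)) r s)

AllZero : Poly → Set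
AllZero = All (_≡ 0ℚ)

module _ {n : ℕ} (X : Mat n) where

  evalM-+P : ∀ p q → evalM (p +P q) X ≈M (evalM p X +M evalM q X)
  evalM-+P []      q       r s = sym (ℚₚ.+-identityˡ _)
  evalM-+P (x ∷ p) []      r s = sym (ℚₚ.+-identityʳ _)
  evalM-+P (x ∷ p) (y ∷ q) r s = begin
    (x + y) * idM r s + (X *M evalM (p +P q) X) r s
      ≡⟨ cong ((x + y) * idM r s +_)
              (trans (*M-congˡ X (evalM-+P p q) r s) (*M-distribˡ X (evalM p X) (evalM q X) r s)) ⟩
    (x + y) * idM r s + ((X *M evalM p X) r s + (X *M evalM q X) r s)
      ≡⟨ solve 5 (λ x y i a b → (x :+ y) :* i :+ (a :+ b) := (x :* i :+ a) :+ (y :* i :+ b))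
               refl x y (idM r s) _ _ ⟩
    (x * idM r s + (X *M evalM p X) r s) + (y * idM r s + (X *M evalM q X) r s) ∎
    where open ≡-Reasoning

  evalM-·P : ∀ k p → evalM (k ·P p) X ≈M (k ·M evalM p X)
  evalM-·P k []      r s = sym (ℚₚ.*-zeroʳ k)
  evalM-·P k (x ∷ p) r s = begin
    (k * x) * idM r s + (X *M evalM (k ·P p) X) r s
      ≡⟨ cong ((k * x) * idM r s +_)
              (trans (*M-congˡ X (evalM-·P k p) r s) (*M-·Mʳ k X (evalM p X) r s)) ⟩
    (k * x) * idM r s + k * (X *M evalM p X) r s
      ≡⟨ solve 4 (λ k x i a → (k :* x) :* i :+ k :* a := k :* (x :* i :+ a)) refl k x (idM r s) _ ⟩
    k * (x * idM r s + (X *M evalM p X) r s) ∎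
    where open ≡-Reasoning

  evalM-λ·P : ∀ p → evalM (λ·P p) X ≈M (X *M evalM p X)
  evalM-λ·P p r s = trans (cong (_+ (X *M evalM p X) r s) (ℚₚ.*-zeroˡ (idM r s))) (ℚₚ.+-identityˡ _)

  evalM-const : ∀ x → evalM (x ∷ []) X ≈M (x ·M idM)
  evalM-const x r s = trans (cong (x * idM r s +_) (*M-zeroʳ X r s)) (ℚₚ.+-identityʳ _)

  evalM-commute : ∀ {Y} p → Commute Y X → Commute Y (evalM p X)
  evalM-commute {Y} []      YX≈XY = commute-zeroM Y
  evalM-commute {Y} (x ∷ p) YX≈XY =
    commute-+M {X = Y} {x ·M idM} {X *M evalM p X} (commute-scalar Y x)
      (commute-*M {X = Y} {X} {evalM p X} YX≈XY (evalM-commute p YX≈XY))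

  evalM-evalM-commute : ∀ p q → Commute (evalM p X) (evalM q X)
  evalM-evalM-commute p q =
    evalM-commute q (commute-sym {X = X} {evalM p X} (evalM-commute p (λ r s → refl)))

  evalM-linCombP : ∀ {m} (κ : Fin m → ℚ) (ps : Fin m → Poly) →
                   evalM (linCombP κ ps) X ≈M LinComb κ (λ i → evalM (ps i) X)
  evalM-linCombP {zero}  κ ps r s = refl
  evalM-linCombP {suc m} κ ps r s = trans (evalM-+P (κ fzero ·P ps fzero) _ r s)
    (cong₂ _+_ (evalM-·P (κ fzero) (ps fzero) r s) (evalM-linCombP (λ i → κ (fsuc i)) (λ i → ps (fsuc i)) r s))

  evalM-AllZero : ∀ p → AllZero p → evalM p X ≈M zeroM
  evalM-AllZero []      []           r s = refl
  evalM-AllZero (x ∷ p) (refl ∷ p≡0) r s = begin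
    0ℚ * idM r s + (X *M evalM p X) r s
      ≡⟨ cong₂ _+_ (ℚₚ.*-zeroˡ (idM r s)) (*M-congˡ X (evalM-AllZero p p≡0) r s) ⟩
    0ℚ + (X *M zeroM) r s
      ≡⟨ cong (0ℚ +_) (*M-zeroʳ X r s) ⟩
    0ℚ + 0ℚ
      ≡⟨⟩
    0ℚ ∎
    where open ≡-Reasoning

ev : Poly → ℚ → ℚ
ev []      t = 0ℚ
ev (x ∷ p) t = x + t * ev p t

ev-+P : ∀ p q t → ev (p +P q) t ≡ ev p t + ev q t
ev-+P []      q       t = sym (ℚₚ.+-identityˡ _)
ev-+P (x ∷ p) []      t = sym (ℚₚ.+-identityʳ _)
ev-+P (x ∷ p) (y ∷ q) t = trans (cong (λ e → (x + y) + t * e) (ev-+P p q t))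
  (solve 5 (λ x y t a b → (x :+ y) :+ t :* (a :+ b) := (x :+ t :* a) :+ (y :+ t :* b)) refl x y t (ev p t) (ev q t))

ev-·P : ∀ k p t → ev (k ·P p) t ≡ k * ev p t
ev-·P k []      t = sym (ℚₚ.*-zeroʳ k)
ev-·P k (x ∷ p) t = trans (cong (λ e → k * x + t * e) (ev-·P k p t))
  (solve 4 (λ k x t a → k :* x :+ t :* (k :* a) := k :* (x :+ t :* a)) refl k x t (ev p t))

ev-λ·P : ∀ p t → ev (λ·P p) t ≡ t * ev p t
ev-λ·P p t = ℚₚ.+-identityˡ _

ev-linCombP : ∀ {m} (κ : Fin m → ℚ) (ps : Fin m → Poly) t →
              ev (linCombP κ ps) t ≡ ΣF (λ i → κ i * ev (ps i) t)
ev-linCombP {zero}  κ ps t = refl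
ev-linCombP {suc m} κ ps t = trans (ev-+P (κ fzero ·P ps fzero) _ t)
  (cong₂ _+_ (ev-·P (κ fzero) (ps fzero) t) (ev-linCombP (λ i → κ (fsuc i)) (λ i → ps (fsuc i)) t))

evalM-diagonal : ∀ {n} (X : Mat n) (t : Fin n → ℚ) → (∀ r s → X r s ≡ t r * idM r s) →
                 ∀ p r s → evalM p X r s ≡ ev p (t r) * idM r s
evalM-diagonal X t X≡diag []      r s = sym (ℚₚ.*-zeroˡ (idM r s))
evalM-diagonal X t X≡diag (x ∷ p) r s = begin
  x * idM r s + ΣF (λ j → X r j * evalM p X j s)
    ≡⟨ cong (x * idM r s +_) (ΣF-cong (λ j → cong₂ _*_ (X≡diag r j) (evalM-diagonal X t X≡diag p j s))) ⟩
  x * idM r s + ΣF (λ j → t r * idM r j * E j)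
    ≡⟨ cong (x * idM r s +_) (ΣF-cong (λ j → ℚₚ.*-assoc (t r) (idM r j) (E j))) ⟩
  x * idM r s + ΣF (λ j → t r * (idM r j * E j))
    ≡⟨ cong (x * idM r s +_)
            (trans (sym (*-distribˡ-ΣF (t r) (λ j → idM r j * E j))) (cong (t r *_) (ΣF-idMˡ r E))) ⟩
  x * idM r s + t r * (ev p (t r) * idM r s)
    ≡⟨ solve 4 (λ x i θ e → x :* i :+ θ :* (e :* i) := (x :+ θ :* e) :* i)
               refl x (idM r s) (t r) (ev p (t r)) ⟩
  (x + t r * ev p (t r)) * idM r s ∎
  where
  open ≡-Reasoning
  E : Fin _ → ℚ
  E j = ev p (t j) * idM j s

length-+P : ∀ {L} p q → length p ≤ L → length q ≤ L → length (p +P q) ≤ L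
length-+P []      q       _         len-q     = len-q
length-+P (x ∷ p) []      len-p     _         = len-p
length-+P (x ∷ p) (y ∷ q) (s≤s len-p) (s≤s len-q) = s≤s (length-+P p q len-p len-q)

length-·P : ∀ k p → length (k ·P p) ≡ length p
length-·P k []      = refl
length-·P k (x ∷ p) = cong suc (length-·P k p)

length-·P-≤ : ∀ {L} k p → length p ≤ L → length (k ·P p) ≤ L
length-·P-≤ k p = subst (_≤ _) (sym (length-·P k p))

length-linCombP : ∀ {m L} (κ : Fin m → ℚ) (ps : Fin m → Poly) →
                  (∀ i → length (ps i) ≤ L) → length (linCombP κ ps) ≤ L
length-linCombP {zero}  κ ps _   = z≤n
length-linCombP {suc m} κ ps len = length-+P (κ fzero ·P ps fzero) _
  (length-·P-≤ (κ fzero) (ps fzero) (len fzero))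
  (length-linCombP (λ i → κ (fsuc i)) (λ i → ps (fsuc i)) (λ i → len (fsuc i)))

-- Roots and interpolation

divLinear : ℚ → Poly → Poly × ℚ
divLinear t []              = [] , 0ℚ
divLinear t (x ∷ [])        = [] , x
divLinear t (x ∷ y ∷ p) = let (q , ρ) = divLinear t (y ∷ p) in (ρ ∷ q) , x + t * ρ

quotient : ℚ → Poly → Poly
quotient t p = proj₁ (divLinear t p)

remainder : ℚ → Poly → ℚ
remainder t p = proj₂ (divLinear t p)

ev-divLinear : ∀ t p s → ev p s ≡ (s - t) * ev (quotient t p) s + remainder t p
ev-divLinear t []       s = solve 2 (λ s t → con 0ℚ := (s :- t) :* con 0ℚ :+ con 0ℚ) refl s t
ev-divLinear t (x ∷ []) s =
  solve 3 (λ x s t → x :+ s :* con 0ℚ := (s :- t) :* con 0ℚ :+ x) refl x s t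
ev-divLinear t (x ∷ p@(_ ∷ _)) s = trans (cong (λ e → x + s * e) (ev-divLinear t p s))
  (solve 5 (λ x s t q ρ → x :+ s :* ((s :- t) :* q :+ ρ) := (s :- t) :* (ρ :+ s :* q) :+ (x :+ t :* ρ))
         refl x s t (ev (quotient t p) s) (remainder t p))

length-quotient : ∀ t p {m} → length p ≤ suc m → length (quotient t p) ≤ m
length-quotient t []              _         = z≤n
length-quotient t (x ∷ [])        _         = z≤n
length-quotient t (x ∷ p@(_ ∷ _)) {suc m} (s≤s len) = s≤s (length-quotient t p len)

AllZero-divLinear : ∀ t p → AllZero (quotient t p) → remainder t p ≡ 0ℚ → AllZero p
AllZero-divLinear t []              _          _   = []
AllZero-divLinear t (x ∷ [])        _          x≡0 = x≡0 ∷ []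
AllZero-divLinear t (x ∷ p@(_ ∷ _)) (ρ≡0 ∷ q≡0) r≡0 =
  x≡0 ∷ AllZero-divLinear t p q≡0 ρ≡0
  where
  x≡0 : x ≡ 0ℚ
  x≡0 = begin
    x                          ≡⟨ solve 2 (λ x t → x := x :+ t :* con 0ℚ) refl x t ⟩
    x + t * 0ℚ                 ≡⟨ cong (λ ρ → x + t * ρ) ρ≡0 ⟨
    x + t * remainder t p      ≡⟨ r≡0 ⟩
    0ℚ                         ∎
    where open ≡-Reasoning

module _ {n} {t : Fin (suc n) → ℚ} (t-inj : Injective _≡_ _≡_ t) where

  tail-injective : Injective _≡_ _≡_ (λ j → t (fsuc j))
  tail-injective e = suc-injective (t-inj e)

  tail-head≢0 : ∀ j → t (fsuc j) - t fzero ≢ 0ℚ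
  tail-head≢0 j e = 0≢1+n (sym (t-inj (p-q≡0⇒p≡q _ _ e)))

roots⇒AllZero : ∀ n (t : Fin n → ℚ) → Injective _≡_ _≡_ t →
                ∀ p → length p ≤ n → (∀ j → ev p (t j) ≡ 0ℚ) → AllZero p
roots⇒AllZero zero    _ _     []  _   _     = []
roots⇒AllZero (suc m) t t-inj p   len roots = AllZero-divLinear t₀ p
  (roots⇒AllZero m (λ j → t (fsuc j)) (tail-injective t-inj) (quotient t₀ p)
     (length-quotient t₀ p len) quotient-roots)
  remainder≡0
  where
  open ≡-Reasoning
  t₀ = t fzero
  remainder≡0 : remainder t₀ p ≡ 0ℚ
  remainder≡0 = begin
    remainder t₀ p
      ≡⟨ solve 3 (λ t q ρ → ρ := (t :- t) :* q :+ ρ) refl t₀ (ev (quotient t₀ p) t₀) (remainder t₀ p) ⟩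
    (t₀ - t₀) * ev (quotient t₀ p) t₀ + remainder t₀ p
      ≡⟨ ev-divLinear t₀ p t₀ ⟨
    ev p t₀
      ≡⟨ roots fzero ⟩
    0ℚ ∎
  quotient-roots : ∀ j → ev (quotient t₀ p) (t (fsuc j)) ≡ 0ℚ
  quotient-roots j = p≢0∧p*q≡0⇒q≡0 (tail-head≢0 t-inj j) (begin
    (tⱼ - t₀) * ev (quotient t₀ p) tⱼ
      ≡⟨ ℚₚ.+-identityʳ _ ⟨
    (tⱼ - t₀) * ev (quotient t₀ p) tⱼ + 0ℚ
      ≡⟨ cong ((tⱼ - t₀) * ev (quotient t₀ p) tⱼ +_) remainder≡0 ⟨
    (tⱼ - t₀) * ev (quotient t₀ p) tⱼ + remainder t₀ p
      ≡⟨ ev-divLinear t₀ p tⱼ ⟨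
    ev p tⱼ
      ≡⟨ roots (fsuc j) ⟩
    0ℚ ∎)
    where tⱼ = t (fsuc j)

mulLinear : ℚ → Poly → Poly
mulLinear t h = λ·P h +P (- t) ·P h

ev-mulLinear : ∀ t h s → ev (mulLinear t h) s ≡ (s - t) * ev h s
ev-mulLinear t h s = begin
  ev (λ·P h +P (- t) ·P h) s       ≡⟨ ev-+P (λ·P h) ((- t) ·P h) s ⟩
  ev (λ·P h) s + ev ((- t) ·P h) s ≡⟨ cong₂ _+_ (ev-λ·P h s) (ev-·P (- t) h s) ⟩
  s * ev h s + (- t) * ev h s      ≡⟨ ℚₚ.*-distribʳ-+ (ev h s) s (- t) ⟨
  (s - t) * ev h s                 ∎
  where open ≡-Reasoning

length-mulLinear : ∀ {m} t h → length h ≤ m → length (mulLinear t h) ≤ suc m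
length-mulLinear t h len =
  length-+P (λ·P h) ((- t) ·P h) (s≤s len) (length-·P-≤ (- t) h (ℕₚ.m≤n⇒m≤1+n len))

-- Newton interpolation: q = y₀ + (λ - t₀) h, where h interpolates the divided differences.
interpolate : ∀ n (t : Fin n → ℚ) → Injective _≡_ _≡_ t → (y : Fin n → ℚ) →
              Σ Poly λ q → length q ≤ n × (∀ j → ev q (t j) ≡ y j)
interpolate zero    _ _     _ = [] , z≤n , λ ()
interpolate (suc m) t t-inj y = q , length-q , q-interpolates
  where
  open ≡-Reasoning
  t₀ = t fzero
  y₀ = y fzero
  divided : Fin m → ℚ
  divided j = (y (fsuc j) - y₀) ÷' (t (fsuc j) - t₀)
  IH = interpolate m (λ j → t (fsuc j)) (tail-injective t-inj) divided
  h = proj₁ IH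
  q = (y₀ ∷ []) +P mulLinear t₀ h
  length-q : length q ≤ suc m
  length-q = length-+P (y₀ ∷ []) (mulLinear t₀ h) (s≤s z≤n) (length-mulLinear t₀ h (proj₁ (proj₂ IH)))
  ev-q : ∀ s → ev q s ≡ y₀ + (s - t₀) * ev h s
  ev-q s = begin
    ev q s
      ≡⟨ ev-+P (y₀ ∷ []) (mulLinear t₀ h) s ⟩
    (y₀ + s * 0ℚ) + ev (mulLinear t₀ h) s
      ≡⟨ cong₂ _+_ (solve 2 (λ y s → y :+ s :* con 0ℚ := y) refl y₀ s) (ev-mulLinear t₀ h s) ⟩
    y₀ + (s - t₀) * ev h s ∎
  q-interpolates : ∀ j → ev q (t j) ≡ y j
  q-interpolates fzero = trans (ev-q t₀)
    (solve 3 (λ y t e → y :+ (t :- t) :* e := y) refl y₀ t₀ (ev h t₀))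
  q-interpolates (fsuc j) = begin
    ev q tⱼ
      ≡⟨ ev-q tⱼ ⟩
    y₀ + (tⱼ - t₀) * ev h tⱼ
      ≡⟨ cong (λ e → y₀ + (tⱼ - t₀) * e) (proj₂ (proj₂ IH) j) ⟩
    y₀ + (tⱼ - t₀) * divided j
      ≡⟨ cong (y₀ +_) (q*[p÷'q]≡p (y (fsuc j) - y₀) (tail-head≢0 t-inj j)) ⟩
    y₀ + (y (fsuc j) - y₀)
      ≡⟨ solve 2 (λ a b → a :+ (b :- a) := b) refl y₀ (y (fsuc j)) ⟩
    y (fsuc j) ∎
    where tⱼ = t (fsuc j)

-- Spans and bases

module _ (g : ℕ → ℚ → ℚ) where

  InSpan : ℕ → (ℚ → ℚ) → Set
  InSpan n f = Σ (Fin n → ℚ) λ κ → ∀ t → f t ≡ ΣF (λ i → κ i * g (toℕ i) t)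

  span-ext : ∀ {n f f'} → (∀ t → f t ≡ f' t) → InSpan n f → InSpan n f'
  span-ext f≗f' (κ , f≡) = κ , λ t → trans (sym (f≗f' t)) (f≡ t)

  span-zero : ∀ {n} → InSpan n (λ _ → 0ℚ)
  span-zero {n} = (λ _ → 0ℚ) , λ t → sym (trans (ΣF-cong {n} (λ i → ℚₚ.*-zeroˡ (g (toℕ i) t))) (ΣF-zero n))

  span-+ : ∀ {n f f'} → InSpan n f → InSpan n f' → InSpan n (λ t → f t + f' t)
  span-+ {f = f} {f'} (κ , f≡) (κ' , f'≡) = (λ i → κ i + κ' i) , λ t → begin
    f t + f' t
      ≡⟨ cong₂ _+_ (f≡ t) (f'≡ t) ⟩
    ΣF (λ i → κ i * g (toℕ i) t) + ΣF (λ i → κ' i * g (toℕ i) t)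
      ≡⟨ ΣF-distrib-+ (λ i → κ i * g (toℕ i) t) (λ i → κ' i * g (toℕ i) t) ⟨
    ΣF (λ i → κ i * g (toℕ i) t + κ' i * g (toℕ i) t)
      ≡⟨ ΣF-cong (λ i → ℚₚ.*-distribʳ-+ (g (toℕ i) t) (κ i) (κ' i)) ⟨
    ΣF (λ i → (κ i + κ' i) * g (toℕ i) t) ∎
    where open ≡-Reasoning

  span-scale : ∀ {n f} α → InSpan n f → InSpan n (λ t → α * f t)
  span-scale {f = f} α (κ , f≡) = (λ i → α * κ i) , λ t → begin
    α * f t                               ≡⟨ cong (α *_) (f≡ t) ⟩
    α * ΣF (λ i → κ i * g (toℕ i) t)     ≡⟨ *-distribˡ-ΣF α (λ i → κ i * g (toℕ i) t) ⟩
    ΣF (λ i → α * (κ i * g (toℕ i) t))   ≡⟨ ΣF-cong (λ i → ℚₚ.*-assoc α (κ i) (g (toℕ i) t)) ⟨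
    ΣF (λ i → α * κ i * g (toℕ i) t)     ∎
    where open ≡-Reasoning

  span-gen : ∀ {n i} → i < n → InSpan n (g i)
  span-gen {n} {i} i<n = (λ j → idM j (fromℕ< i<n)) , λ t → sym (begin
    ΣF (λ j → idM j (fromℕ< i<n) * g (toℕ j) t)
      ≡⟨ ΣF-cong (λ j → cong (_* g (toℕ j) t) (idM-sym j (fromℕ< i<n))) ⟩
    ΣF (λ j → idM (fromℕ< i<n) j * g (toℕ j) t)
      ≡⟨ ΣF-idMˡ (fromℕ< i<n) (λ j → g (toℕ j) t) ⟩
    g (toℕ (fromℕ< i<n)) t
      ≡⟨ cong (λ k → g k t) (toℕ-fromℕ< i<n) ⟩
    g i t ∎)
    where open ≡-Reasoning

  span-ΣF : ∀ {m n} (fs : Fin m → ℚ → ℚ) → (∀ j → InSpan n (fs j)) →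
            InSpan n (λ t → ΣF (λ j → fs j t))
  span-ΣF {zero}  fs _       = span-zero
  span-ΣF {suc m} fs fs-span = span-+ (fs-span fzero) (span-ΣF (λ j → fs (fsuc j)) (λ j → fs-span (fsuc j)))

  span-mono : ∀ {m n f} → m ≤ n → InSpan m f → InSpan n f
  span-mono m≤n (κ , f≡) = span-ext (λ t → sym (f≡ t))
    (span-ΣF (λ i t → κ i * g (toℕ i) t) (λ i → span-scale (κ i) (span-gen (ℕₚ.<-≤-trans (toℕ<n i) m≤n))))

  ev-inSpan : ∀ N → (∀ t → g 0 t ≡ 1ℚ) →
              (∀ i → suc i < N → InSpan (suc (suc i)) (λ t → t * g i t)) →
              ∀ {n} q → length q ≤ n → n ≤ N → InSpan n (ev q)
  ev-inSpan _ _    _                []      _         _   = span-zero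
  ev-inSpan N g0≡1 shift {suc m} (x ∷ q) (s≤s len) n≤N = span-ext ev≡
    (span-+ (span-scale x (span-gen (s≤s z≤n)))
            (span-ΣF (λ i t → κ i * (t * g (toℕ i) t))
                     (λ i → span-scale (κ i) (span-mono (s≤s (toℕ<n i))
                                               (shift (toℕ i) (ℕₚ.<-≤-trans (s≤s (toℕ<n i)) n≤N))))))
    where
    open ≡-Reasoning
    IH = ev-inSpan N g0≡1 shift q len (ℕₚ.≤-trans (ℕₚ.n≤1+n m) n≤N)
    κ = proj₁ IH
    ev≡ : ∀ t → x * g 0 t + ΣF (λ i → κ i * (t * g (toℕ i) t)) ≡ x + t * ev q t
    ev≡ t = begin
      x * g 0 t + ΣF (λ i → κ i * (t * g (toℕ i) t))
        ≡⟨ cong₂ _+_ (trans (cong (x *_) (g0≡1 t)) (ℚₚ.*-identityʳ x))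
                     (ΣF-cong (λ i → solve 3 (λ k t e → k :* (t :* e) := t :* (k :* e)) refl (κ i) t (g (toℕ i) t))) ⟩
      x + ΣF (λ i → t * (κ i * g (toℕ i) t))
        ≡⟨ cong (x +_) (*-distribˡ-ΣF t (λ i → κ i * g (toℕ i) t)) ⟨
      x + t * ΣF (λ i → κ i * g (toℕ i) t)
        ≡⟨ cong (λ e → x + t * e) (proj₂ IH t) ⟨
      x + t * ev q t ∎

span-rescale : ∀ {g h : ℕ → ℚ → ℚ} {n f} (α : ℕ → ℚ) →
               (∀ i → i < n → ∀ t → g i t ≡ α i * h i t) → InSpan g n f → InSpan h n f
span-rescale {h = h} α g≡αh (κ , f≡) = (λ i → κ i * α (toℕ i)) , λ t → trans (f≡ t)
  (ΣF-cong (λ i → trans (cong (κ i *_) (g≡αh (toℕ i) (toℕ<n i) t))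
                        (sym (ℚₚ.*-assoc (κ i) (α (toℕ i)) (h (toℕ i) t)))))

LinIndepP : ∀ {m} → (Fin m → Poly) → Set
LinIndepP ps = ∀ κ → AllZero (linCombP κ ps) → ∀ i → κ i ≡ 0ℚ

LinIndep-evalM⇒LinIndepP : ∀ {m n} (X : Mat n) (ps : Fin m → Poly) →
                           LinIndep (λ i → evalM (ps i) X) → LinIndepP ps
LinIndep-evalM⇒LinIndepP X ps indep κ κps≡0 =
  indep κ (λ r s → trans (sym (evalM-linCombP X κ ps r s)) (evalM-AllZero X (linCombP κ ps) κps≡0 r s))

module _ {n : ℕ} (X : Mat n) (P : ℕ → Poly) where

  private
    Bs : Fin n → Mat n
    Bs i = evalM (P (toℕ i)) X

  cyclic-basis : (c : Fin n) → (∀ i r → Bs i r c ≡ idM r i) →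
                 IsBasisOf (InSubalgebraGen X) Bs
  cyclic-basis c Bs-column = (λ i → P (toℕ i) , λ r s → refl) , independent , spanning
    where
    open ≡-Reasoning

    LinComb-column : ∀ κ r → LinComb κ Bs r c ≡ κ r
    LinComb-column κ r = begin
      LinComb κ Bs r c             ≡⟨ LinComb-entry κ Bs r c ⟩
      ΣF (λ i → κ i * Bs i r c)    ≡⟨ ΣF-cong (λ i → cong (κ i *_) (trans (Bs-column i r) (idM-sym r i))) ⟩
      ΣF (λ i → κ i * idM i r)     ≡⟨ ΣF-idMʳ r κ ⟩
      κ r                          ∎

    -- p (X) e s = p (X) (Bs s e c) = Bs s (p (X) e c), as polynomials in X commute.
    column-expansion : ∀ p r s → evalM p X r s ≡ ΣF (λ j → Bs s r j * evalM p X j c)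
    column-expansion p r s = begin
      evalM p X r s                             ≡⟨ ΣF-idMʳ s (evalM p X r) ⟨
      ΣF (λ j → evalM p X r j * idM j s)        ≡⟨ ΣF-cong (λ j → cong (evalM p X r j *_) (Bs-column s j)) ⟨
      (evalM p X *M Bs s) r c                   ≡⟨ evalM-evalM-commute X p (P (toℕ s)) r c ⟩
      ΣF (λ j → Bs s r j * evalM p X j c)       ∎

    independent : LinIndep Bs
    independent κ κBs≈0 i = trans (sym (LinComb-column κ i)) (κBs≈0 i c)

    spanning : ∀ Y → InSubalgebraGen X Y → Σ (Fin n → ℚ) λ κ → Y ≈M LinComb κ Bs
    spanning Y (p , Y≈pX) = κ , λ r s → begin
      Y r s                                   ≡⟨ Y≈pX r s ⟩
      evalM p X r s                           ≡⟨ column-expansion p r s ⟩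
      ΣF (λ j → Bs s r j * evalM p X j c)     ≡⟨ ΣF-cong (λ j → cong (Bs s r j *_) (sym (q-column j))) ⟩
      ΣF (λ j → Bs s r j * evalM q X j c)     ≡⟨ column-expansion q r s ⟨
      evalM q X r s                           ≡⟨ evalM-linCombP X κ (λ i → P (toℕ i)) r s ⟩
      LinComb κ Bs r s                        ∎
      where
      κ : Fin n → ℚ
      κ j = evalM p X j c
      q = linCombP κ (λ i → P (toℕ i))
      q-column : ∀ j → evalM q X j c ≡ κ j
      q-column j = trans (evalM-linCombP X κ (λ i → P (toℕ i)) j c) (LinComb-column κ j)

  diagonal-basis : (t : Fin n → ℚ) → Injective _≡_ _≡_ t → (∀ r s → X r s ≡ t r * idM r s) →
                   (∀ i → length (P (toℕ i)) ≤ n) → LinIndepP (λ i → P (toℕ i)) →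
                   (∀ q → length q ≤ n → InSpan (λ i → ev (P i)) n (ev q)) →
                   IsBasisOf (InSubalgebraGen X) Bs
  diagonal-basis t t-inj X-diag P-length P-indep ev-span =
    (λ i → P (toℕ i) , λ r s → refl) , independent , spanning
    where
    open ≡-Reasoning

    Bs-entry : ∀ i r s → Bs i r s ≡ ev (P (toℕ i)) (t r) * idM r s
    Bs-entry i = evalM-diagonal X t X-diag (P (toℕ i))

    independent : LinIndep Bs
    independent κ κBs≈0 = P-indep κ (roots⇒AllZero n t t-inj κP
      (length-linCombP κ (λ i → P (toℕ i)) P-length) roots)
      where
      κP = linCombP κ (λ i → P (toℕ i))
      roots : ∀ j → ev κP (t j) ≡ 0ℚ
      roots j = begin
        ev κP (t j)                                  ≡⟨ ev-linCombP κ (λ i → P (toℕ i)) (t j) ⟩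
        ΣF (λ i → κ i * ev (P (toℕ i)) (t j))        ≡⟨ ΣF-cong (λ i → cong (κ i *_) (Bs-diag i)) ⟨
        ΣF (λ i → κ i * Bs i j j)                    ≡⟨ LinComb-entry κ Bs j j ⟨
        LinComb κ Bs j j                             ≡⟨ κBs≈0 j j ⟩
        0ℚ                                           ∎
        where
        Bs-diag : ∀ i → Bs i j j ≡ ev (P (toℕ i)) (t j)
        Bs-diag i = trans (Bs-entry i j j)
          (trans (cong (ev (P (toℕ i)) (t j) *_) (idM-refl j)) (ℚₚ.*-identityʳ _))

    spanning : ∀ Y → InSubalgebraGen X Y → Σ (Fin n → ℚ) λ κ → Y ≈M LinComb κ Bs
    spanning Y (p , Y≈pX) = κ , λ r s → begin
      Y r s
        ≡⟨ Y≈pX r s ⟩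
      evalM p X r s
        ≡⟨ evalM-diagonal X t X-diag p r s ⟩
      ev p (t r) * idM r s
        ≡⟨ cong (_* idM r s) (proj₂ (proj₂ interp) r) ⟨
      ev q (t r) * idM r s
        ≡⟨ cong (_* idM r s) (proj₂ q-span (t r)) ⟩
      ΣF (λ i → κ i * ev (P (toℕ i)) (t r)) * idM r s
        ≡⟨ *-distribʳ-ΣF (idM r s) (λ i → κ i * ev (P (toℕ i)) (t r)) ⟩
      ΣF (λ i → κ i * ev (P (toℕ i)) (t r) * idM r s)
        ≡⟨ ΣF-cong (λ i → trans (ℚₚ.*-assoc (κ i) _ _) (cong (κ i *_) (sym (Bs-entry i r s)))) ⟩
      ΣF (λ i → κ i * Bs i r s)
        ≡⟨ LinComb-entry κ Bs r s ⟨
      LinComb κ Bs r s ∎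
      where
      interp = interpolate n t t-inj (λ j → ev p (t j))
      q = proj₁ interp
      q-span = ev-span q (proj₁ (proj₂ interp))
      κ = proj₁ q-span

-- The matrices A and A*

m≢0∧n≢0⇒m*n≢0 : ∀ {m n} → m ≢ 0 → n ≢ 0 → m ℕ.* n ≢ 0
m≢0∧n≢0⇒m*n≢0 {m} m≢0 n≢0 mn≡0 with ℕₚ.m*n≡0⇒m≡0∨n≡0 m mn≡0
... | inj₁ m≡0 = m≢0 m≡0
... | inj₂ n≡0 = n≢0 n≡0

frac-cong : ∀ {m d m′ d′} → d ≢ 0 → d′ ≢ 0 → m ℕ.* d′ ≡ m′ ℕ.* d → frac m d ≡ frac m′ d′
frac-cong {d = zero}                    d≢0 _    _ = ⊥-elim (d≢0 refl)
frac-cong {d = suc _} {d′ = zero}       _   d′≢0 _ = ⊥-elim (d′≢0 refl)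
frac-cong {m} {suc d} {m′} {suc d′} _ _ md′≡m′d = ℚₚ.fromℚᵘ-cong
  {mkℚᵘ (ℤ.+ m) d} {mkℚᵘ (ℤ.+ m′) d′}
  (*≡* (trans (sym (ℤₚ.pos-* m (suc d′))) (trans (cong ℤ.+_ md′≡m′d) (ℤₚ.pos-* m′ (suc d)))))

frac-injective : ∀ {m d m′ d′} → d ≢ 0 → d′ ≢ 0 → frac m d ≡ frac m′ d′ → m ℕ.* d′ ≡ m′ ℕ.* d
frac-injective {d = zero}              d≢0 _    _ = ⊥-elim (d≢0 refl)
frac-injective {d = suc _} {d′ = zero} _   d′≢0 _ = ⊥-elim (d′≢0 refl)
frac-injective {m} {suc d} {m′} {suc d′} _ _ eq = ℚₚ.normalize-injective-≃ m m′ (suc d) (suc d′) eq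

frac≢0 : ∀ m d → m ≢ 0 → d ≢ 0 → frac m d ≢ 0ℚ
frac≢0 m d m≢0 d≢0 eq = m≢0 (trans (sym (ℕₚ.*-identityʳ m)) (frac-injective {m′ = 0} {d′ = 1} d≢0 (λ ()) eq))

3n[n+1]-mono-< : ∀ {m n} → m < n → 3 ℕ.* m ℕ.* (m ℕ.+ 1) < 3 ℕ.* n ℕ.* (n ℕ.+ 1)
3n[n+1]-mono-< m<n = ℕₚ.*-mono-< (ℕₚ.*-monoʳ-< 3 m<n) (ℕₚ.+-monoˡ-< 1 m<n)

3n[n+1]-injective : ∀ {m n} → 3 ℕ.* m ℕ.* (m ℕ.+ 1) ≡ 3 ℕ.* n ℕ.* (n ℕ.+ 1) → m ≡ n
3n[n+1]-injective {m} {n} eq with ℕₚ.<-cmp m n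
... | tri< m<n _ _ = ⊥-elim (ℕₚ.<-irrefl eq (3n[n+1]-mono-< m<n))
... | tri≈ _ m≡n _ = m≡n
... | tri> _ _ n<m = ⊥-elim (ℕₚ.<-irrefl (sym eq) (3n[n+1]-mono-< n<m))

module _ (D : ℕ) where

  -- Column j of A is b (j - 1) e (j - 1) + a j e j + c (j + 1) e (j + 1); for j = 0 the
  -- junk term b (pred 0) is killed by δ (suc i) 0 = 0.
  Aentry : ℕ → ℕ → ℚ
  Aentry i j = a D j * δ i j + (b D (ℕ.pred j) * δ (suc i) j + c D (suc j) * δ i (suc j))

  Aentry-δ : ∀ {i j x y z} → δ i j ≡ x → δ (suc i) j ≡ y → δ i (suc j) ≡ z →
             Aentry i j ≡ a D j * x + (b D (ℕ.pred j) * y + c D (suc j) * z)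
  Aentry-δ refl refl refl = refl

  Amat-entry : ∀ r s → Amat D r s ≡ Aentry (toℕ r) (toℕ s)
  Amat-entry r s with toℕ r | toℕ s
  ... | i | j with i ℕ.≟ j | suc i ℕ.≟ j | i ℕ.≟ suc j
  ... | yes refl | _        | _        = sym (trans
    (Aentry-δ (δ-refl i) (δ-≢ {suc i} ℕₚ.1+n≢n) (δ-≢ {i} (ℕₚ.<⇒≢ (ℕₚ.n<1+n i))))
    (solve 3 (λ a b c → a :* con 1ℚ :+ (b :* con 0ℚ :+ c :* con 0ℚ) := a) refl (a D i) (b D (ℕ.pred i)) (c D (suc i))))
  ... | no _     | yes refl | _        = sym (trans
    (Aentry-δ {i} {suc i} (δ-≢ {i} (ℕₚ.<⇒≢ (ℕₚ.n<1+n i))) (δ-refl i)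
                          (δ-≢ {i} (ℕₚ.<⇒≢ (ℕₚ.m<n⇒m<1+n (ℕₚ.n<1+n i)))))
    (solve 3 (λ a b c → a :* con 0ℚ :+ (b :* con 1ℚ :+ c :* con 0ℚ) := b) refl (a D (suc i)) (b D i) (c D (suc (suc i)))))
  ... | no _     | no _     | yes refl = sym (trans
    (Aentry-δ (δ-≢ {suc j} ℕₚ.1+n≢n) (δ-≢ {suc (suc j)} (ℕₚ.>⇒≢ (ℕₚ.m<n⇒m<1+n (ℕₚ.n<1+n j)))) (δ-refl j))
    (solve 3 (λ a b c → a :* con 0ℚ :+ (b :* con 0ℚ :+ c :* con 1ℚ) := c) refl (a D j) (b D (ℕ.pred j)) (c D (suc j))))
  ... | no i≢j   | no 1+i≢j | no i≢1+j = sym (trans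
    (Aentry-δ (δ-≢ i≢j) (δ-≢ 1+i≢j) (δ-≢ i≢1+j))
    (solve 3 (λ a b c → a :* con 0ℚ :+ (b :* con 0ℚ :+ c :* con 0ℚ) := con 0ℚ) refl (a D j) (b D (ℕ.pred j)) (c D (suc j))))

  A-column : ∀ (Y : Mat (suc D)) w j → j < suc D → (∀ s → Y s fzero ≡ w * δ (toℕ s) j) →
             ∀ r → (Amat D *M Y) r fzero ≡ w * Aentry (toℕ r) j
  A-column Y w j j<1+D Y-column r = begin
    ΣF (λ s → Amat D r s * Y s fzero)
      ≡⟨ ΣF-cong (λ s → cong (Amat D r s *_) (trans (Y-column s) (cong (w *_) (δ≡idM s)))) ⟩
    ΣF (λ s → Amat D r s * (w * idM s ĵ))
      ≡⟨ ΣF-cong (λ s → solve 3 (λ x w i → x :* (w :* i) := w :* (x :* i)) refl (Amat D r s) w (idM s ĵ)) ⟩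
    ΣF (λ s → w * (Amat D r s * idM s ĵ))
      ≡⟨ *-distribˡ-ΣF w (λ s → Amat D r s * idM s ĵ) ⟨
    w * ΣF (λ s → Amat D r s * idM s ĵ)
      ≡⟨ cong (w *_) (ΣF-idMʳ ĵ (Amat D r)) ⟩
    w * Amat D r ĵ
      ≡⟨ cong (w *_) (trans (Amat-entry r ĵ) (cong (Aentry (toℕ r)) (toℕ-fromℕ< j<1+D))) ⟩
    w * Aentry (toℕ r) j ∎
    where
    open ≡-Reasoning
    ĵ = fromℕ< j<1+D
    δ≡idM : ∀ s → δ (toℕ s) j ≡ idM s ĵ
    δ≡idM s = trans (cong (δ (toℕ s)) (sym (toℕ-fromℕ< j<1+D))) (sym (idM≡δ s ĵ))

  A*mat-diagonal : ∀ r s → A*mat D r s ≡ θ D (toℕ r) * idM r s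
  A*mat-diagonal r s with toℕ r ℕ.≟ toℕ s
  ... | yes r≡s = sym (trans (cong (θ D (toℕ r) *_) (trans (idM≡δ r s)
                                (trans (cong (δ (toℕ r)) (sym r≡s)) (δ-refl (toℕ r)))))
                             (ℚₚ.*-identityʳ (θ D (toℕ r))))
  ... | no r≢s  = sym (trans (cong (θ D (toℕ r) *_) (trans (idM≡δ r s) (δ-≢ r≢s)))
                             (ℚₚ.*-zeroʳ (θ D (toℕ r))))

  -- u D (suc (suc m)) unfolds definitionally to (1ℚ ÷' b D (suc m)) ·P u-step m.
  u-step : ℕ → Poly
  u-step m = λ·P (u D (suc m)) +P ((- a D (suc m)) ·P u D (suc m) +P (- c D (suc m)) ·P u D m)

  u-length : ∀ i → length (u D i) ≤ suc i
  u-length zero          = s≤s z≤n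
  u-length (suc zero)    = s≤s (s≤s z≤n)
  u-length (suc (suc m)) = length-·P-≤ (1ℚ ÷' b D (suc m)) (u-step m)
    (length-+P (λ·P (u D (suc m))) ((- a D (suc m)) ·P u D (suc m) +P (- c D (suc m)) ·P u D m)
      (s≤s (u-length (suc m)))
      (length-+P ((- a D (suc m)) ·P u D (suc m)) ((- c D (suc m)) ·P u D m)
        (length-·P-≤ (- a D (suc m)) (u D (suc m)) (ℕₚ.m≤n⇒m≤1+n (u-length (suc m))))
        (length-·P-≤ (- c D (suc m)) (u D m) (ℕₚ.m≤n⇒m≤1+n (ℕₚ.m≤n⇒m≤1+n (u-length m))))))

  v-length : ∀ i → i ≤ D → length (v D i) ≤ suc D
  v-length i i≤D = length-·P-≤ (k D i) (u D i) (ℕₚ.≤-trans (u-length i) (s≤s i≤D))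

  evalM-u-step : ∀ {n} (X : Mat n) m r s → evalM (u-step m) X r s ≡
    (X *M evalM (u D (suc m)) X) r s
      + ((- a D (suc m)) * evalM (u D (suc m)) X r s + (- c D (suc m)) * evalM (u D m) X r s)
  evalM-u-step X m r s = begin
    evalM (λ·P u₁ +P (-a ·P u₁ +P -c ·P u₀)) X r s
      ≡⟨ evalM-+P X (λ·P u₁) (-a ·P u₁ +P -c ·P u₀) r s ⟩
    evalM (λ·P u₁) X r s + evalM (-a ·P u₁ +P -c ·P u₀) X r s
      ≡⟨ cong (evalM (λ·P u₁) X r s +_) (evalM-+P X (-a ·P u₁) (-c ·P u₀) r s) ⟩
    evalM (λ·P u₁) X r s + (evalM (-a ·P u₁) X r s + evalM (-c ·P u₀) X r s)
      ≡⟨ cong₂ _+_ (evalM-λ·P X u₁ r s) (cong₂ _+_ (evalM-·P X -a u₁ r s) (evalM-·P X -c u₀ r s)) ⟩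
    (X *M evalM u₁ X) r s + (-a * evalM u₁ X r s + -c * evalM u₀ X r s) ∎
    where
    open ≡-Reasoning
    -a = - a D (suc m)
    -c = - c D (suc m)
    u₀ = u D m
    u₁ = u D (suc m)

  ev-u-step : ∀ m t → ev (u-step m) t ≡
    t * ev (u D (suc m)) t + ((- a D (suc m)) * ev (u D (suc m)) t + (- c D (suc m)) * ev (u D m) t)
  ev-u-step m t = begin
    ev (λ·P u₁ +P (-a ·P u₁ +P -c ·P u₀)) t
      ≡⟨ ev-+P (λ·P u₁) (-a ·P u₁ +P -c ·P u₀) t ⟩
    ev (λ·P u₁) t + ev (-a ·P u₁ +P -c ·P u₀) t
      ≡⟨ cong (ev (λ·P u₁) t +_) (ev-+P (-a ·P u₁) (-c ·P u₀) t) ⟩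
    ev (λ·P u₁) t + (ev (-a ·P u₁) t + ev (-c ·P u₀) t)
      ≡⟨ cong₂ _+_ (ev-λ·P u₁ t) (cong₂ _+_ (ev-·P -a u₁ t) (ev-·P -c u₀ t)) ⟩
    t * ev u₁ t + (-a * ev u₁ t + -c * ev u₀ t) ∎
    where
    open ≡-Reasoning
    -a = - a D (suc m)
    -c = - c D (suc m)
    u₀ = u D m
    u₁ = u D (suc m)

module _ (D : ℕ) (D≢0 : D ≢ 0) where

  private
    D[D+2]≢0 : D ℕ.* (D ℕ.+ 2) ≢ 0
    D[D+2]≢0 = m≢0∧n≢0⇒m*n≢0 D≢0 (ℕₚ.m+1+n≢0 D)

    D[D+2][2i+1]≢0 : ∀ i → D ℕ.* (D ℕ.+ 2) ℕ.* (2 ℕ.* i ℕ.+ 1) ≢ 0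
    D[D+2][2i+1]≢0 i = m≢0∧n≢0⇒m*n≢0 D[D+2]≢0 (ℕₚ.m+1+n≢0 (2 ℕ.* i))

  b≢0 : ∀ {i} → i < D → b D i ≢ 0ℚ
  b≢0 {i} i<D = frac≢0
    (3 ℕ.* (D ℕ.∸ i) ℕ.* (i ℕ.+ 1) ℕ.* (D ℕ.+ i ℕ.+ 2)) (D ℕ.* (D ℕ.+ 2) ℕ.* (2 ℕ.* i ℕ.+ 1))
    (m≢0∧n≢0⇒m*n≢0 (m≢0∧n≢0⇒m*n≢0 (m≢0∧n≢0⇒m*n≢0 {3} (λ ()) (ℕₚ.m>n⇒m∸n≢0 i<D)) (ℕₚ.m+1+n≢0 i {0}))
                   (ℕₚ.m+1+n≢0 (D ℕ.+ i) {1}))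
    (D[D+2][2i+1]≢0 i)

  c≢0 : ∀ i → c D (suc i) ≢ 0ℚ
  c≢0 i = frac≢0
    (3 ℕ.* ((D ℕ.∸ suc i) ℕ.+ 1) ℕ.* suc i ℕ.* (D ℕ.+ suc i ℕ.+ 1)) (D ℕ.* (D ℕ.+ 2) ℕ.* (2 ℕ.* suc i ℕ.+ 1))
    (m≢0∧n≢0⇒m*n≢0 (m≢0∧n≢0⇒m*n≢0 (m≢0∧n≢0⇒m*n≢0 {3} (λ ()) (ℕₚ.m+1+n≢0 (D ℕ.∸ suc i) {0})) (λ ()))
                   (ℕₚ.m+1+n≢0 (D ℕ.+ suc i) {0}))
    (D[D+2][2i+1]≢0 (suc i))

  a-zero : a D 0 ≡ 0ℚ
  a-zero = frac-cong {0} {D ℕ.* (D ℕ.+ 2)} {0} {1} D[D+2]≢0 (λ ()) refl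

  b-zero : b D 0 ≡ frac 3 1
  b-zero = frac-cong {3 ℕ.* (D ℕ.∸ 0) ℕ.* (0 ℕ.+ 1) ℕ.* (D ℕ.+ 0 ℕ.+ 2)}
                     {D ℕ.* (D ℕ.+ 2) ℕ.* (2 ℕ.* 0 ℕ.+ 1)} {3} {1}
    (D[D+2][2i+1]≢0 0) (λ ())
    (solveℕ 1 (λ d → (conℕ 3 ⊗ d ⊗ conℕ 1 ⊗ (d ⊕ conℕ 0 ⊕ conℕ 2)) ⊗ conℕ 1
                      ⊜ conℕ 3 ⊗ (d ⊗ (d ⊕ conℕ 2) ⊗ conℕ 1)) refl D)
    where
    open ℕ-Solver.+-*-Solver using ()
      renaming (solve to solveℕ; con to conℕ; _:*_ to _⊗_; _:+_ to _⊕_; _:=_ to _⊜_)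

  θ-injective : ∀ {i j} → θ D i ≡ θ D j → i ≡ j
  θ-injective {i} {j} θi≡θj = 3n[n+1]-injective (ℕₚ.*-cancelʳ-≡ _ _ (D ℕ.* (D ℕ.+ 2)) {{ℕ.≢-nonZero D[D+2]≢0}}
    (frac-injective D[D+2]≢0 D[D+2]≢0
      (trans (a-from-θ i) (trans (cong (λ x → (frac 3 1 - x) * frac 1 2) θi≡θj) (sym (a-from-θ j))))))
    where
    a-from-θ : ∀ n → a D n ≡ (frac 3 1 - θ D n) * frac 1 2
    a-from-θ n = solve 1 (λ x → x := (con (frac 3 1) :- (con (frac 3 1) :+ :- (con (frac 2 1) :* x))) :* con (frac 1 2))
                         refl (a D n)

  -- 1 / k i = (c 1 ⋯ c i) / (b 0 ⋯ b (i - 1)), in the recursive form the three-term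
  -- recurrence produces (u i (A) e 0 = k⁻¹ i e i).
  k⁻¹ : ℕ → ℚ
  k⁻¹ zero    = 1ℚ
  k⁻¹ (suc i) = (1ℚ ÷' b D i) * (k⁻¹ i * c D (suc i))

  b*k⁻¹-suc : ∀ {i} → i < D → b D i * k⁻¹ (suc i) ≡ k⁻¹ i * c D (suc i)
  b*k⁻¹-suc {i} i<D = begin
    b D i * ((1ℚ ÷' b D i) * (k⁻¹ i * c D (suc i)))
      ≡⟨ ℚₚ.*-assoc (b D i) _ _ ⟨
    (b D i * (1ℚ ÷' b D i)) * (k⁻¹ i * c D (suc i))
      ≡⟨ cong (_* (k⁻¹ i * c D (suc i))) (q*[p÷'q]≡p 1ℚ (b≢0 i<D)) ⟩
    1ℚ * (k⁻¹ i * c D (suc i))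
      ≡⟨ ℚₚ.*-identityˡ _ ⟩
    k⁻¹ i * c D (suc i) ∎
    where open ≡-Reasoning

  prodC≢0 : ∀ i → prodC D i ≢ 0ℚ
  prodC≢0 zero    = λ ()
  prodC≢0 (suc i) = p≢0∧q≢0⇒p*q≢0 (prodC≢0 i) (c≢0 i)

  k⁻¹*prodB≡prodC : ∀ i → i ≤ D → k⁻¹ i * prodB D i ≡ prodC D i
  k⁻¹*prodB≡prodC zero    _   = refl
  k⁻¹*prodB≡prodC (suc i) i<D = begin
    k⁻¹ (suc i) * (prodB D i * b D i)
      ≡⟨ solve 3 (λ x p b → x :* (p :* b) := (b :* x) :* p) refl (k⁻¹ (suc i)) (prodB D i) (b D i) ⟩
    (b D i * k⁻¹ (suc i)) * prodB D i
      ≡⟨ cong (_* prodB D i) (b*k⁻¹-suc i<D) ⟩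
    (k⁻¹ i * c D (suc i)) * prodB D i
      ≡⟨ solve 3 (λ x c p → (x :* c) :* p := (x :* p) :* c) refl (k⁻¹ i) (c D (suc i)) (prodB D i) ⟩
    (k⁻¹ i * prodB D i) * c D (suc i)
      ≡⟨ cong (_* c D (suc i)) (k⁻¹*prodB≡prodC i (ℕₚ.<⇒≤ i<D)) ⟩
    prodC D i * c D (suc i) ∎
    where open ≡-Reasoning

  k*k⁻¹≡1 : ∀ i → i ≤ D → k D i * k⁻¹ i ≡ 1ℚ
  k*k⁻¹≡1 i i≤D = begin
    (prodB D i ÷' prodC D i) * k⁻¹ i
      ≡⟨ cong (_* k⁻¹ i) (p÷'q≡p*1/q (prodB D i) (prodC≢0 i)) ⟩
    (prodB D i * C⁻¹) * k⁻¹ i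
      ≡⟨ solve 3 (λ p c x → (p :* c) :* x := c :* (x :* p)) refl (prodB D i) C⁻¹ (k⁻¹ i) ⟩
    C⁻¹ * (k⁻¹ i * prodB D i)
      ≡⟨ cong (C⁻¹ *_) (k⁻¹*prodB≡prodC i i≤D) ⟩
    C⁻¹ * prodC D i
      ≡⟨ ℚₚ.*-inverseˡ (prodC D i) {{≢-nonZero (prodC≢0 i)}} ⟩
    1ℚ ∎
    where
    open ≡-Reasoning
    C⁻¹ = 1/_ (prodC D i) {{≢-nonZero (prodC≢0 i)}}

  u-column : ∀ i → i ≤ D → ∀ r → evalM (u D i) (Amat D) r fzero ≡ k⁻¹ i * δ (toℕ r) i
  u-column zero          _     r = trans (evalM-const (Amat D) 1ℚ r fzero) (cong (1ℚ *_) (idM≡δ r fzero))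
  u-column (suc zero)    _     r = begin
    0ℚ * idM r fzero + (Amat D *M evalM (frac 1 3 ∷ []) (Amat D)) r fzero
      ≡⟨ cong₂ _+_ (ℚₚ.*-zeroˡ (idM r fzero))
                   (A-column D (evalM (frac 1 3 ∷ []) (Amat D)) (frac 1 3) 0 (s≤s z≤n) third-e₀ r) ⟩
    0ℚ + frac 1 3 * (a D 0 * δ ρ 0 + (b D 0 * 0ℚ + c D 1 * δ ρ 1))
      ≡⟨ cong (λ x → 0ℚ + frac 1 3 * (x * δ ρ 0 + (b D 0 * 0ℚ + c D 1 * δ ρ 1))) a-zero ⟩
    0ℚ + frac 1 3 * (0ℚ * δ ρ 0 + (b D 0 * 0ℚ + c D 1 * δ ρ 1))
      ≡⟨ solve 5 (λ d₀ b c d₁ t → con 0ℚ :+ t :* (con 0ℚ :* d₀ :+ (b :* con 0ℚ :+ c :* d₁)) := t :* (con 1ℚ :* c) :* d₁)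
               refl (δ ρ 0) (b D 0) (c D 1) (δ ρ 1) (frac 1 3) ⟩
    frac 1 3 * (1ℚ * c D 1) * δ ρ 1
      ≡⟨ cong (λ x → (1ℚ ÷' x) * (1ℚ * c D 1) * δ ρ 1) b-zero ⟨
    k⁻¹ 1 * δ ρ 1 ∎
    where
    open ≡-Reasoning
    ρ = toℕ r
    third-e₀ : ∀ s → evalM (frac 1 3 ∷ []) (Amat D) s fzero ≡ frac 1 3 * δ (toℕ s) 0
    third-e₀ s = trans (evalM-const (Amat D) (frac 1 3) s fzero) (cong (frac 1 3 *_) (idM≡δ s fzero))
  u-column (suc (suc m)) 2+m≤D r = begin
    evalM (u D (suc (suc m))) A r fzero
      ≡⟨ evalM-·P A β (u-step D m) r fzero ⟩
    β * evalM (u-step D m) A r fzero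
      ≡⟨ cong (β *_) (evalM-u-step D A m r fzero) ⟩
    β * ((A *M U₁) r fzero + (- a₁ * U₁ r fzero + - c₁ * U₀ r fzero))
      ≡⟨ cong₂ (λ x y → β * (x + y))
               (A-column D U₁ (k⁻¹ (suc m)) (suc m) (s≤s 1+m≤D) (u-column (suc m) 1+m≤D) r)
               (cong₂ (λ x y → - a₁ * x + - c₁ * y) (u-column (suc m) 1+m≤D r) (u-column m (ℕₚ.<⇒≤ 1+m≤D) r)) ⟩
    β * (k⁻¹ (suc m) * Aentry D ρ (suc m) + (- a₁ * (k⁻¹ (suc m) * δ ρ (suc m)) + - c₁ * (k⁻¹ m * δ ρ m)))
      ≡⟨ solve 10 (λ β κ₁ κ₀ a₁ b₀ c₁ c₂ d₀ d₁ d₂ →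
                     β :* (κ₁ :* (a₁ :* d₁ :+ (b₀ :* d₀ :+ c₂ :* d₂)) :+ ((:- a₁) :* (κ₁ :* d₁) :+ (:- c₁) :* (κ₀ :* d₀)))
                  := β :* (κ₁ :* c₂) :* d₂ :+ β :* (b₀ :* κ₁ :- κ₀ :* c₁) :* d₀)
               refl β (k⁻¹ (suc m)) (k⁻¹ m) a₁ (b D m) c₁ (c D (suc (suc m))) (δ ρ m) (δ ρ (suc m)) (δ ρ (suc (suc m))) ⟩
    k⁻¹ (suc (suc m)) * δ ρ (suc (suc m)) + β * (b D m * k⁻¹ (suc m) - k⁻¹ m * c₁) * δ ρ m
      ≡⟨ cong (λ x → k⁻¹ (suc (suc m)) * δ ρ (suc (suc m)) + β * (x - k⁻¹ m * c₁) * δ ρ m)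
              (b*k⁻¹-suc (ℕₚ.<⇒≤ 2+m≤D)) ⟩
    k⁻¹ (suc (suc m)) * δ ρ (suc (suc m)) + β * (k⁻¹ m * c₁ - k⁻¹ m * c₁) * δ ρ m
      ≡⟨ solve 5 (λ x d β y d₀ → x :* d :+ β :* (y :- y) :* d₀ := x :* d)
               refl (k⁻¹ (suc (suc m))) (δ ρ (suc (suc m))) β (k⁻¹ m * c₁) (δ ρ m) ⟩
    k⁻¹ (suc (suc m)) * δ ρ (suc (suc m)) ∎
    where
    open ≡-Reasoning
    A = Amat D
    ρ = toℕ r
    β = 1ℚ ÷' b D (suc m)
    a₁ = a D (suc m)
    c₁ = c D (suc m)
    1+m≤D = ℕₚ.<⇒≤ 2+m≤D
    U₀ = evalM (u D m) A
    U₁ = evalM (u D (suc m)) A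

  B-column : ∀ (i r : Fin (suc D)) → B D i r fzero ≡ idM r i
  B-column i r = begin
    evalM (k D ι ·P u D ι) (Amat D) r fzero ≡⟨ evalM-·P (Amat D) (k D ι) (u D ι) r fzero ⟩
    k D ι * evalM (u D ι) (Amat D) r fzero  ≡⟨ cong (k D ι *_) (u-column ι ι≤D r) ⟩
    k D ι * (k⁻¹ ι * δ (toℕ r) ι)           ≡⟨ ℚₚ.*-assoc (k D ι) (k⁻¹ ι) _ ⟨
    (k D ι * k⁻¹ ι) * δ (toℕ r) ι           ≡⟨ cong (_* δ (toℕ r) ι) (k*k⁻¹≡1 ι ι≤D) ⟩
    1ℚ * δ (toℕ r) ι                        ≡⟨ ℚₚ.*-identityˡ _ ⟩
    δ (toℕ r) ι                             ≡⟨ idM≡δ r i ⟨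
    idM r i                                 ∎
    where
    open ≡-Reasoning
    ι = toℕ i
    ι≤D = ℕₚ.≤-pred (toℕ<n i)

  u-three-term : ∀ m → suc m < D → ∀ t →
    t * ev (u D (suc m)) t ≡
    b D (suc m) * ev (u D (suc (suc m))) t + (a D (suc m) * ev (u D (suc m)) t + c D (suc m) * ev (u D m) t)
  u-three-term m 1+m<D t = begin
    t * U₁
      ≡⟨ solve 5 (λ t U₁ U₀ a c → t :* U₁ := con 1ℚ :* (t :* U₁ :+ ((:- a) :* U₁ :+ (:- c) :* U₀))
                                                :+ (a :* U₁ :+ c :* U₀))
               refl t U₁ U₀ a₁ c₁ ⟩
    1ℚ * E + (a₁ * U₁ + c₁ * U₀)
      ≡⟨ cong (λ x → x * E + (a₁ * U₁ + c₁ * U₀)) (q*[p÷'q]≡p 1ℚ (b≢0 1+m<D)) ⟨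
    (b₁ * β) * E + (a₁ * U₁ + c₁ * U₀)
      ≡⟨ cong (_+ (a₁ * U₁ + c₁ * U₀)) (ℚₚ.*-assoc b₁ β E) ⟩
    b₁ * (β * E) + (a₁ * U₁ + c₁ * U₀)
      ≡⟨ cong (λ x → b₁ * x + (a₁ * U₁ + c₁ * U₀))
              (trans (ev-·P β (u-step D m) t) (cong (β *_) (ev-u-step D m t))) ⟨
    b₁ * ev (u D (suc (suc m))) t + (a₁ * U₁ + c₁ * U₀) ∎
    where
    open ≡-Reasoning
    a₁ = a D (suc m)
    b₁ = b D (suc m)
    c₁ = c D (suc m)
    β = 1ℚ ÷' b₁
    U₀ = ev (u D m) t
    U₁ = ev (u D (suc m)) t
    E = t * U₁ + (- a₁ * U₁ + - c₁ * U₀)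

  u-shift : ∀ i → suc i < suc D → InSpan (λ j → ev (u D j)) (suc (suc i)) (λ t → t * ev (u D i) t)
  u-shift zero    _         = span-ext g
    (λ t → solve 1 (λ t → con (frac 3 1) :* (con 0ℚ :+ t :* (con (frac 1 3) :+ t :* con 0ℚ))
                        := t :* (con 1ℚ :+ t :* con 0ℚ)) refl t)
    (span-scale g (frac 3 1) (span-gen g (ℕₚ.n<1+n 1)))
    where g = λ j → ev (u D j)
  u-shift (suc m) 2+m<1+D = span-ext g (λ t → sym (u-three-term m (ℕₚ.≤-pred 2+m<1+D) t))
    (span-+ g (span-scale g (b D (suc m)) (span-gen g (ℕₚ.n<1+n (suc (suc m)))))
      (span-+ g (span-scale g (a D (suc m)) (span-gen g (ℕₚ.m<n⇒m<1+n (ℕₚ.n<1+n (suc m)))))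
                (span-scale g (c D (suc m)) (span-gen g (ℕₚ.m<n⇒m<1+n (ℕₚ.m<n⇒m<1+n (ℕₚ.n<1+n m)))))))
    where g = λ j → ev (u D j)

  v-spans : ∀ q → length q ≤ suc D → InSpan (λ i → ev (v D i)) (suc D) (ev q)
  v-spans q len = span-rescale k⁻¹ u≡k⁻¹v
    (ev-inSpan (λ i → ev (u D i)) (suc D) (λ t → solve 1 (λ t → con 1ℚ :+ t :* con 0ℚ := con 1ℚ) refl t)
               u-shift q len ℕₚ.≤-refl)
    where
    u≡k⁻¹v : ∀ i → i < suc D → ∀ t → ev (u D i) t ≡ k⁻¹ i * ev (v D i) t
    u≡k⁻¹v i i<1+D t = sym (begin
      k⁻¹ i * ev (k D i ·P u D i) t
        ≡⟨ cong (k⁻¹ i *_) (ev-·P (k D i) (u D i) t) ⟩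
      k⁻¹ i * (k D i * ev (u D i) t)
        ≡⟨ solve 3 (λ x y e → x :* (y :* e) := (y :* x) :* e) refl (k⁻¹ i) (k D i) (ev (u D i) t) ⟩
      (k D i * k⁻¹ i) * ev (u D i) t
        ≡⟨ cong (_* ev (u D i) t) (k*k⁻¹≡1 i (ℕₚ.≤-pred i<1+D)) ⟩
      1ℚ * ev (u D i) t
        ≡⟨ ℚₚ.*-identityˡ _ ⟩
      ev (u D i) t                    ∎)
      where open ≡-Reasoning

lemma4p5 : (D : ℕ) → 1 ≤ D →
    IsBasisOf (InSubalgebraGen (Amat D)) (B D) ×
    IsBasisOf (InSubalgebraGen (A*mat D)) (B* D)
lemma4p5 D 1≤D = A-basis , A*-basis
  where
  D≢0 = ℕₚ.n>0⇒n≢0 1≤D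
  A-basis = cyclic-basis (Amat D) (v D) fzero (B-column D D≢0)
  A*-basis = diagonal-basis (A*mat D) (v D) (λ r → θ D (toℕ r))
    (λ θr≡θs → toℕ-injective (θ-injective D D≢0 θr≡θs))
    (A*mat-diagonal D)
    (λ i → v-length D (toℕ i) (ℕₚ.≤-pred (toℕ<n i)))
    (LinIndep-evalM⇒LinIndepP (Amat D) (λ i → v D (toℕ i)) (proj₁ (proj₂ A-basis)))
    (v-spans D D≢0)
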